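{- Let $C_n$ be the total number of 1-descents, summed over all prefixes of dispersed Dyck paths of length $n$ (paths with arbitrary final height). Then \[ \sum_{n\ge0}C_nz^n=\frac{z^2}{2(1-2z)^2}+\frac{z^2\sqrt{1-4z^2}}{2(1-2z)^2}. \]
   Context: A prefix of a dispersed Dyck path of length $n$ is a sequence of $n$ steps, each an up-step $U=(1,1)$, a down-step $D=(1,-1)$, or a flat step $H=(1,0)$, starting at $(0,0)$, never going below the $x$-axis, such that flat steps occur only on the $x$-axis (from $(k,0)$ to $(k+1,0)$); the endpoint may be at any height $\ge0$. A descent is a maximal run of consecutive $D$ steps (a run at the end of the path also counts); a 1-descent is a descent consisting of exactly one $D$ step. -}

module Defs where

open import Data.Nat using (ℕ; zero; suc; _∸_) renaming (_+_ to _+ℕ_)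
open import Data.Integer using (ℤ; +_; -_; _+_; _*_)
open import Data.List using (List; []; _∷_; [_]; concatMap; filter; map)
open import Data.Nat.ListAction using (sum)
open import Data.Bool using (Bool; true; false; T)
open import Data.Product using (_×_; Σ)
open import Relation.Binary.PropositionalEquality using (_≡_)
open import Relation.Nullary.Decidable using (Dec; yes; no)

data Step : Set where
  U D H : Step

extend : List Step → List (List Step)
extend w = (U ∷ w) ∷ (D ∷ w) ∷ (H ∷ w) ∷ []

words : ℕ → List (List Step)
words zero = [ [] ]
words (suc n) = concatMap extend (words n)

-- validity of a prefix of a dispersed Dyck path started at height h:
-- never below the x-axis, flat steps only on the x-axis.
validFrom : ℕ → List Step → Bool
validFrom h [] = true
validFrom h (U ∷ p) = validFrom (suc h) p
validFrom zero (D ∷ p) = false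
validFrom (suc h) (D ∷ p) = validFrom h p
validFrom zero (H ∷ p) = validFrom zero p
validFrom (suc h) (H ∷ p) = false

isPrefixDDP : List Step → Bool
isPrefixDDP = validFrom zero

prefixesDDP : ℕ → List (List Step)
prefixesDDP n = filter (λ p → Data.Bool._≟_ (isPrefixDDP p) true) (words n)
  where import Data.Bool

-- number of 1-descents: maximal runs of D of length exactly 1
-- (a run at the end of the path also counts).  k = length of the current D-run.
isOne : ℕ → ℕ
isOne (suc zero) = 1
isOne _ = 0

oneDescGo : ℕ → List Step → ℕ
oneDescGo k [] = isOne k
oneDescGo k (D ∷ p) = oneDescGo (suc k) p
oneDescGo k (U ∷ p) = isOne k +ℕ oneDescGo zero p
oneDescGo k (H ∷ p) = isOne k +ℕ oneDescGo zero p

oneDescents : List Step → ℕ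
oneDescents = oneDescGo zero

C : ℕ → ℕ
C n = sum (map oneDescents (prefixesDDP n))

Series : Set
Series = ℕ → ℤ

sumTo : (ℕ → ℤ) → ℕ → ℤ
sumTo f zero = f zero
sumTo f (suc n) = sumTo f n + f (suc n)

_⊛_ : Series → Series → Series
(f ⊛ g) n = sumTo (λ i → f i * g (n ∸ i)) n

_⊕_ : Series → Series → Series
(f ⊕ g) n = f n + g n

one : Series
one zero = + 1
one (suc _) = + 0

z²· : Series → Series
z²· f zero = + 0
z²· f (suc zero) = + 0
z²· f (suc (suc n)) = f n

oneMinus4z² : Series
oneMinus4z² zero = + 1
oneMinus4z² (suc (suc zero)) = - (+ 4)
oneMinus4z² _ = + 0

-- the polynomial 2 (1 - 2 z)^2 = 2 - 8 z + 8 z^2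
twoOneMinus2zSq : Series
twoOneMinus2zSq zero = + 2
twoOneMinus2zSq (suc zero) = - (+ 8)
twoOneMinus2zSq (suc (suc zero)) = + 8
twoOneMinus2zSq _ = + 0

IsSqrt1-4z² : Series → Set
IsSqrt1-4z² S = (S zero ≡ + 1) × (∀ n → (S ⊛ S) n ≡ oneMinus4z² n)

Cgf : Series
Cgf n = + (C n)

-- Let T n h k be the total number of 1-descents of the valid step words of length n started at
-- height h inside a descent run of length k.  From every height exactly two steps are allowed, so
-- there are 2ⁿ such words, and splitting off the first step gives linear recurrences for T in
-- which k ≥ 2 behaves like k = 2.  Eliminating k gives G (n+3) h = 2 G (n+2) h + 2ⁿ + Z n h for
-- G n h = T n h 2, where Z n h counts the dispersed walks from h ending on the axis.  As
-- C (n+1) = G (n+1) 0 and Z (n+1) 0 + Q (n+1) 1 = 2 Z n 0 for the first-passage numbers Q,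
-- C (n+4) − 4 C (n+3) + 4 C (n+2) = − Q (n+1) 1, i.e. 2 (1 − 2z)² Σ C n zⁿ = z² + z² S with
-- S = 1 − 2 Σ Q n 1 zⁿ⁺¹.  Cutting a first passage from 2 at its first visit to 1 gives
-- S² = 1 − 4z², and a square root with constant term 1 is unique, since the (n+1)-st coefficient
-- of S² is 2 S (n+1) plus terms in lower coefficients.

module Submission where

open import Defs
open import Data.Product using (_×_; Σ; _,_)
open import Relation.Binary.PropositionalEquality using (_≡_; refl; sym; trans; cong; cong₂; module ≡-Reasoning)
import Data.Integer as ℤ

module Walks where

  open import Data.Nat using (ℕ; zero; suc; _+_; _*_; _∸_)
  open import Data.Nat.Properties using (+-identityʳ; +-assoc; *-distribʳ-+; *-distribˡ-+)
  open import Data.Nat.Tactic.RingSolver using (solve-∀)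

  sumToℕ : (ℕ → ℕ) → ℕ → ℕ
  sumToℕ f zero = f zero
  sumToℕ f (suc n) = sumToℕ f n + f (suc n)

  sumToℕ-cong : ∀ f g n → (∀ i → f i ≡ g i) → sumToℕ f n ≡ sumToℕ g n
  sumToℕ-cong f g zero f≗g = f≗g 0
  sumToℕ-cong f g (suc n) f≗g = cong₂ _+_ (sumToℕ-cong f g n f≗g) (f≗g (suc n))

  sumToℕ-+ : ∀ f g n → sumToℕ (λ i → f i + g i) n ≡ sumToℕ f n + sumToℕ g n
  sumToℕ-+ f g zero = refl
  sumToℕ-+ f g (suc n) rewrite sumToℕ-+ f g n = interchange (sumToℕ f n) (sumToℕ g n) (f (suc n)) (g (suc n))
    where
    interchange : ∀ a b c d → (a + b) + (c + d) ≡ (a + c) + (b + d)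
    interchange = solve-∀

  sumToℕ-* : ∀ c f n → sumToℕ (λ i → c * f i) n ≡ c * sumToℕ f n
  sumToℕ-* c f zero = refl
  sumToℕ-* c f (suc n) rewrite sumToℕ-* c f n = sym (*-distribˡ-+ c (sumToℕ f n) (f (suc n)))

  sumToℕ-suc : ∀ f n → sumToℕ f (suc n) ≡ f 0 + sumToℕ (λ i → f (suc i)) n
  sumToℕ-suc f zero = refl
  sumToℕ-suc f (suc n) rewrite sumToℕ-suc f n = +-assoc (f 0) _ _

  sumToℕ-vanishing-tail : ∀ f n → (∀ i → f (suc i) ≡ 0) → sumToℕ f n ≡ f 0
  sumToℕ-vanishing-tail f zero _ = refl
  sumToℕ-vanishing-tail f (suc n) tail≡0 rewrite sumToℕ-vanishing-tail f n tail≡0 | tail≡0 n = +-identityʳ (f 0)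

  firstPassage : ℕ → ℕ → ℕ
  firstPassage zero zero = 1
  firstPassage zero (suc h) = 0
  firstPassage (suc t) zero = 0
  firstPassage (suc t) (suc h) = firstPassage t (suc (suc h)) + firstPassage t h

  dispersedToAxis : ℕ → ℕ → ℕ
  dispersedToAxis zero zero = 1
  dispersedToAxis zero (suc h) = 0
  dispersedToAxis (suc t) zero = dispersedToAxis t 1 + dispersedToAxis t 0
  dispersedToAxis (suc t) (suc h) = dispersedToAxis t (suc (suc h)) + dispersedToAxis t h

  firstPassage-+ : ∀ t g h → firstPassage t (g + h) ≡ sumToℕ (λ i → firstPassage i g * firstPassage (t ∸ i) h) t
  firstPassage-+ zero zero h = sym (+-identityʳ _)
  firstPassage-+ zero (suc g) h = refl
  firstPassage-+ (suc t) zero h = sym (trans (sumToℕ-vanishing-tail _ (suc t) (λ _ → refl)) (+-identityʳ _))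
  firstPassage-+ (suc t) (suc g) h = begin
      firstPassage t (suc (suc g) + h) + firstPassage t (g + h)
    ≡⟨ cong₂ _+_ (firstPassage-+ t (suc (suc g)) h) (firstPassage-+ t g h) ⟩
      sumToℕ (λ i → Q i (suc (suc g)) * Q (t ∸ i) h) t + sumToℕ (λ i → Q i g * Q (t ∸ i) h) t
    ≡⟨ sym (sumToℕ-+ _ _ t) ⟩
      sumToℕ (λ i → Q i (suc (suc g)) * Q (t ∸ i) h + Q i g * Q (t ∸ i) h) t
    ≡⟨ sumToℕ-cong _ _ t (λ i → sym (*-distribʳ-+ (Q (t ∸ i) h) (Q i (suc (suc g))) (Q i g))) ⟩
      sumToℕ (λ i → Q (suc i) (suc g) * Q (t ∸ i) h) t
    ≡⟨ sym (sumToℕ-suc (λ i → Q i (suc g) * Q (suc t ∸ i) h) t) ⟩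
      sumToℕ (λ i → Q i (suc g) * Q (suc t ∸ i) h) (suc t)
    ∎
    where
    open ≡-Reasoning
    Q : ℕ → ℕ → ℕ
    Q = firstPassage

  dispersedToAxis-from-suc : ∀ n h → dispersedToAxis n h ≡ dispersedToAxis n (suc h) + firstPassage (suc n) (suc h)
  dispersedToAxis-from-suc zero zero = refl
  dispersedToAxis-from-suc zero (suc h) = refl
  dispersedToAxis-from-suc (suc n) zero
    rewrite dispersedToAxis-from-suc n 1 | dispersedToAxis-from-suc n 0 =
      shuffle (dispersedToAxis n 2) (firstPassage (suc n) 2) (dispersedToAxis n 1) (firstPassage (suc n) 1)
    where
    shuffle : ∀ a b c d → a + b + (c + d) ≡ a + (c + d) + (b + 0)
    shuffle = solve-∀
  dispersedToAxis-from-suc (suc n) (suc h)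
    rewrite dispersedToAxis-from-suc n (suc (suc h)) | dispersedToAxis-from-suc n h =
      shuffle (dispersedToAxis n (3 + h)) (firstPassage (suc n) (3 + h)) (dispersedToAxis n (suc h)) (firstPassage (suc n) (suc h))
    where
    shuffle : ∀ a b c d → a + b + (c + d) ≡ a + c + (b + d)
    shuffle = solve-∀

  dispersedToAxis-suc-zero : ∀ n → dispersedToAxis (suc n) 0 + firstPassage (suc n) 1 ≡ 2 * dispersedToAxis n 0
  dispersedToAxis-suc-zero n = begin
      Z n 1 + Z n 0 + Q (suc n) 1                  ≡⟨ cong (λ x → Z n 1 + x + Q (suc n) 1) (dispersedToAxis-from-suc n 0) ⟩
      Z n 1 + (Z n 1 + Q (suc n) 1) + Q (suc n) 1  ≡⟨ double (Z n 1) (Q (suc n) 1) ⟩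
      2 * (Z n 1 + Q (suc n) 1)                    ≡⟨ cong (2 *_) (sym (dispersedToAxis-from-suc n 0)) ⟩
      2 * Z n 0                                    ∎
    where
    open ≡-Reasoning
    Z Q : ℕ → ℕ → ℕ
    Z = dispersedToAxis
    Q = firstPassage
    double : ∀ a b → a + (a + b) + b ≡ 2 * (a + b)
    double = solve-∀

module OneDescentCounts where

  open import Data.Nat using (ℕ; zero; suc; _+_; _*_; _^_)
  open import Data.Nat.Properties using (+-identityʳ; +-assoc; *-identityʳ; *-zeroʳ; *-distribˡ-+)
  open import Data.Nat.Tactic.RingSolver using (solve-∀)
  open import Data.Bool using (Bool; true; false; _≟_)
  open import Data.List using (List; []; _∷_; concatMap; filter; map)
  open import Data.Nat.ListAction using (sum)
  open Walks using (firstPassage; dispersedToAxis; dispersedToAxis-suc-zero)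

  sumOver : List (List Step) → (List Step → ℕ) → ℕ
  sumOver ws f = sum (map f ws)

  sumOver-cong : ∀ ws f g → (∀ w → f w ≡ g w) → sumOver ws f ≡ sumOver ws g
  sumOver-cong [] f g f≗g = refl
  sumOver-cong (w ∷ ws) f g f≗g = cong₂ _+_ (f≗g w) (sumOver-cong ws f g f≗g)

  sumOver-+ : ∀ ws f g → sumOver ws (λ w → f w + g w) ≡ sumOver ws f + sumOver ws g
  sumOver-+ [] f g = refl
  sumOver-+ (w ∷ ws) f g rewrite sumOver-+ ws f g = interchange (f w) (g w) _ _
    where
    interchange : ∀ a b c d → a + b + (c + d) ≡ a + c + (b + d)
    interchange = solve-∀

  sumOver-* : ∀ ws c f → sumOver ws (λ w → c * f w) ≡ c * sumOver ws f
  sumOver-* [] c f = sym (*-zeroʳ c)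
  sumOver-* (w ∷ ws) c f rewrite sumOver-* ws c f = sym (*-distribˡ-+ c (f w) _)

  sumOver-extend : ∀ ws f → sumOver (concatMap extend ws) f ≡ sumOver ws (λ w → f (U ∷ w) + f (D ∷ w) + f (H ∷ w))
  sumOver-extend [] f = refl
  sumOver-extend (w ∷ ws) f rewrite sumOver-extend ws f = reassoc (f (U ∷ w)) (f (D ∷ w)) (f (H ∷ w)) _
    where
    reassoc : ∀ a b c d → a + (b + (c + d)) ≡ a + b + c + d
    reassoc = solve-∀

  when : Bool → ℕ → ℕ
  when true n = n
  when false n = 0

  when-+ : ∀ b m n → when b (m + n) ≡ m * when b 1 + when b n
  when-+ true m n = cong (_+ n) (sym (*-identityʳ m))
  when-+ false m n = cong (_+ 0) (sym (*-zeroʳ m))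

  sumValid : ℕ → ℕ → (List Step → ℕ) → ℕ
  sumValid n h f = sumOver (words n) (λ w → when (validFrom h w) (f w))

  sumValid-suc-zero : ∀ n f → sumValid (suc n) 0 f ≡ sumValid n 1 (λ w → f (U ∷ w)) + sumValid n 0 (λ w → f (H ∷ w))
  sumValid-suc-zero n f =
    trans (sumOver-extend (words n) _)
          (trans (sumOver-cong (words n) _ _ (λ w → cong (_+ when (validFrom 0 w) (f (H ∷ w))) (+-identityʳ _)))
                 (sumOver-+ (words n) _ _))

  sumValid-suc-suc : ∀ n h f → sumValid (suc n) (suc h) f ≡ sumValid n (suc (suc h)) (λ w → f (U ∷ w)) + sumValid n h (λ w → f (D ∷ w))
  sumValid-suc-suc n h f =
    trans (sumOver-extend (words n) _)
          (trans (sumOver-cong (words n) _ _ (λ w → +-identityʳ _))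
                 (sumOver-+ (words n) _ _))

  sumValid-1≡2^ : ∀ n h → sumValid n h (λ _ → 1) ≡ 2 ^ n
  sumValid-1≡2^ zero h = refl
  sumValid-1≡2^ (suc n) zero =
    trans (sumValid-suc-zero n _) (cong₂ _+_ (sumValid-1≡2^ n 1) (trans (sumValid-1≡2^ n 0) (sym (+-identityʳ _))))
  sumValid-1≡2^ (suc n) (suc h) =
    trans (sumValid-suc-suc n h _) (cong₂ _+_ (sumValid-1≡2^ n (suc (suc h))) (trans (sumValid-1≡2^ n h) (sym (+-identityʳ _))))

  sumValid-const-+ : ∀ n h c f → sumValid n h (λ w → c + f w) ≡ c * 2 ^ n + sumValid n h f
  sumValid-const-+ n h c f = begin
      sumValid n h (λ w → c + f w)
    ≡⟨ sumOver-cong (words n) _ _ (λ w → when-+ (validFrom h w) c (f w)) ⟩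
      sumOver (words n) (λ w → c * when (validFrom h w) 1 + when (validFrom h w) (f w))
    ≡⟨ sumOver-+ (words n) _ _ ⟩
      sumOver (words n) (λ w → c * when (validFrom h w) 1) + sumValid n h f
    ≡⟨ cong (_+ sumValid n h f) (trans (sumOver-* (words n) c _) (cong (c *_) (sumValid-1≡2^ n h))) ⟩
      c * 2 ^ n + sumValid n h f
    ∎
    where open ≡-Reasoning

  -- The counter k of oneDescGo: the walk is entered inside a descent run of length k.
  oneDescentsFrom : ℕ → ℕ → ℕ → ℕ
  oneDescentsFrom n h k = sumValid n h (oneDescGo k)

  oneDescentsFrom-suc-zero : ∀ n k → oneDescentsFrom (suc n) 0 k
    ≡ (isOne k * 2 ^ n + oneDescentsFrom n 1 0) + (isOne k * 2 ^ n + oneDescentsFrom n 0 0)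
  oneDescentsFrom-suc-zero n k =
    trans (sumValid-suc-zero n (oneDescGo k))
          (cong₂ _+_ (sumValid-const-+ n 1 (isOne k) (oneDescGo 0)) (sumValid-const-+ n 0 (isOne k) (oneDescGo 0)))

  oneDescentsFrom-suc-suc : ∀ n h k → oneDescentsFrom (suc n) (suc h) k
    ≡ (isOne k * 2 ^ n + oneDescentsFrom n (suc (suc h)) 0) + oneDescentsFrom n h (suc k)
  oneDescentsFrom-suc-suc n h k =
    trans (sumValid-suc-suc n h (oneDescGo k))
          (cong (_+ oneDescentsFrom n h (suc k)) (sumValid-const-+ n (suc (suc h)) (isOne k) (oneDescGo 0)))

  oneDescGo-saturates : ∀ k w → oneDescGo (suc (suc k)) w ≡ oneDescGo 2 w
  oneDescGo-saturates k [] = refl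
  oneDescGo-saturates k (U ∷ w) = refl
  oneDescGo-saturates k (H ∷ w) = refl
  oneDescGo-saturates k (D ∷ w) = trans (oneDescGo-saturates (suc k) w) (sym (oneDescGo-saturates 1 w))

  oneDescentsFrom-3 : ∀ n h → oneDescentsFrom n h 3 ≡ oneDescentsFrom n h 2
  oneDescentsFrom-3 n h = sumOver-cong (words n) _ _ (λ w → cong (when (validFrom h w)) (oneDescGo-saturates 1 w))

  sum-filter-isPrefixDDP : ∀ ws → sum (map oneDescents (filter (λ p → isPrefixDDP p ≟ true) ws))
    ≡ sumOver ws (λ w → when (validFrom 0 w) (oneDescGo 0 w))
  sum-filter-isPrefixDDP [] = refl
  sum-filter-isPrefixDDP (w ∷ ws) with validFrom 0 w
  ... | true = cong (oneDescGo 0 w +_) (sum-filter-isPrefixDDP ws)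
  ... | false = sum-filter-isPrefixDDP ws

  C≡oneDescentsFrom : ∀ n → C n ≡ oneDescentsFrom n 0 0
  C≡oneDescentsFrom n = sum-filter-isPrefixDDP (words n)

  startsWithoutD : ℕ → ℕ → ℕ
  startsWithoutD zero h = 1
  startsWithoutD (suc n) zero = 2 * 2 ^ n
  startsWithoutD (suc n) (suc h) = 2 ^ n

  -- Entering after a single D instead of a longer run adds one 1-descent exactly when the run
  -- ends at once, i.e. when the word does not start with D.
  oneDescentsFrom-1 : ∀ n h → oneDescentsFrom n h 1 ≡ oneDescentsFrom n h 2 + startsWithoutD n h
  oneDescentsFrom-1 zero h = refl
  oneDescentsFrom-1 (suc n) zero = begin
      T (suc n) 0 1                                   ≡⟨ oneDescentsFrom-suc-zero n 1 ⟩
      (1 * 2 ^ n + T n 1 0) + (1 * 2 ^ n + T n 0 0)   ≡⟨ shuffle (2 ^ n) (T n 1 0) (T n 0 0) ⟩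
      (T n 1 0 + T n 0 0) + 2 * 2 ^ n                 ≡⟨ cong (_+ 2 * 2 ^ n) (sym (oneDescentsFrom-suc-zero n 2)) ⟩
      T (suc n) 0 2 + 2 * 2 ^ n                       ∎
    where
    open ≡-Reasoning
    T : ℕ → ℕ → ℕ → ℕ
    T = oneDescentsFrom
    shuffle : ∀ p x y → (1 * p + x) + (1 * p + y) ≡ (x + y) + 2 * p
    shuffle = solve-∀
  oneDescentsFrom-1 (suc n) (suc h) = begin
      T (suc n) (suc h) 1                           ≡⟨ oneDescentsFrom-suc-suc n h 1 ⟩
      (1 * 2 ^ n + T n (suc (suc h)) 0) + T n h 2   ≡⟨ shuffle (2 ^ n) (T n (suc (suc h)) 0) (T n h 2) ⟩
      (T n (suc (suc h)) 0 + T n h 2) + 2 ^ n       ≡⟨ cong (λ x → (T n (suc (suc h)) 0 + x) + 2 ^ n) (sym (oneDescentsFrom-3 n h)) ⟩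
      (T n (suc (suc h)) 0 + T n h 3) + 2 ^ n       ≡⟨ cong (_+ 2 ^ n) (sym (oneDescentsFrom-suc-suc n h 2)) ⟩
      T (suc n) (suc h) 2 + 2 ^ n                   ∎
    where
    open ≡-Reasoning
    T : ℕ → ℕ → ℕ → ℕ
    T = oneDescentsFrom
    shuffle : ∀ p x y → (1 * p + x) + y ≡ (x + y) + p
    shuffle = solve-∀

  oneDescentsFrom-suc-suc-2 : ∀ n h → oneDescentsFrom (suc n) (suc h) 2 ≡ oneDescentsFrom n (suc (suc h)) 0 + oneDescentsFrom n h 2
  oneDescentsFrom-suc-suc-2 n h = trans (oneDescentsFrom-suc-suc n h 2) (cong (oneDescentsFrom n (suc (suc h)) 0 +_) (oneDescentsFrom-3 n h))

  oneDescentsFrom-suc-suc-0 : ∀ n h → oneDescentsFrom (suc n) (suc h) 0 ≡ oneDescentsFrom (suc n) (suc h) 2 + startsWithoutD n h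
  oneDescentsFrom-suc-suc-0 n h = begin
      T (suc n) (suc h) 0                         ≡⟨ oneDescentsFrom-suc-suc n h 0 ⟩
      T n (suc (suc h)) 0 + T n h 1               ≡⟨ cong (T n (suc (suc h)) 0 +_) (oneDescentsFrom-1 n h) ⟩
      T n (suc (suc h)) 0 + (T n h 2 + X)         ≡⟨ sym (+-assoc (T n (suc (suc h)) 0) (T n h 2) X) ⟩
      T n (suc (suc h)) 0 + T n h 2 + X           ≡⟨ cong (_+ X) (sym (oneDescentsFrom-suc-suc-2 n h)) ⟩
      T (suc n) (suc h) 2 + X                     ∎
    where
    open ≡-Reasoning
    T : ℕ → ℕ → ℕ → ℕ
    T = oneDescentsFrom
    X : ℕ
    X = startsWithoutD n h

  oneDescentsFrom-suc-zero-0 : ∀ n → oneDescentsFrom (suc n) 0 0 ≡ oneDescentsFrom (suc n) 0 2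
  oneDescentsFrom-suc-zero-0 n = trans (oneDescentsFrom-suc-zero n 0) (sym (oneDescentsFrom-suc-zero n 2))

  oneDescentsFrom-2-step-zero : ∀ n → oneDescentsFrom (2 + n) 0 2
    ≡ oneDescentsFrom (suc n) 1 2 + startsWithoutD n 0 + oneDescentsFrom (suc n) 0 2
  oneDescentsFrom-2-step-zero n =
    trans (oneDescentsFrom-suc-zero (suc n) 2) (cong₂ _+_ (oneDescentsFrom-suc-suc-0 n 0) (oneDescentsFrom-suc-zero-0 n))

  oneDescentsFrom-2-step-suc : ∀ n h → oneDescentsFrom (2 + n) (suc h) 2
    ≡ oneDescentsFrom (suc n) (suc (suc h)) 2 + startsWithoutD n (suc h) + oneDescentsFrom (suc n) h 2
  oneDescentsFrom-2-step-suc n h =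
    trans (oneDescentsFrom-suc-suc-2 (suc n) h) (cong (_+ oneDescentsFrom (suc n) h 2) (oneDescentsFrom-suc-suc-0 n (suc h)))

  oneDescentsFrom-length-1 : ∀ h → oneDescentsFrom 1 h 2 ≡ 0
  oneDescentsFrom-length-1 zero = oneDescentsFrom-suc-zero 0 2
  oneDescentsFrom-length-1 (suc h) = oneDescentsFrom-suc-suc-2 0 h

  oneDescentsFrom-length-2 : ∀ h → oneDescentsFrom 2 h 2 ≡ 1
  oneDescentsFrom-length-2 zero
    rewrite oneDescentsFrom-2-step-zero 0 | oneDescentsFrom-length-1 1 | oneDescentsFrom-length-1 0 = refl
  oneDescentsFrom-length-2 (suc h)
    rewrite oneDescentsFrom-2-step-suc 0 h | oneDescentsFrom-length-1 (suc (suc h)) | oneDescentsFrom-length-1 h = refl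

  oneDescentsFrom-2-recurrence : ∀ n h → oneDescentsFrom (3 + n) h 2 ≡ 2 * oneDescentsFrom (2 + n) h 2 + 2 ^ n + dispersedToAxis n h
  oneDescentsFrom-2-recurrence zero zero = begin
      G 3 0                  ≡⟨ oneDescentsFrom-2-step-zero 1 ⟩
      G 2 1 + 2 + G 2 0      ≡⟨ cong₂ (λ x y → x + 2 + y) (oneDescentsFrom-length-2 1) (oneDescentsFrom-length-2 0) ⟩
      4                      ≡⟨ cong (λ x → 2 * x + 1 + 1) (sym (oneDescentsFrom-length-2 0)) ⟩
      2 * G 2 0 + 1 + 1      ∎
    where
    open ≡-Reasoning
    G : ℕ → ℕ → ℕ
    G n h = oneDescentsFrom n h 2
  oneDescentsFrom-2-recurrence zero (suc h) = begin
      G 3 (suc h)                      ≡⟨ oneDescentsFrom-2-step-suc 1 h ⟩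
      G 2 (suc (suc h)) + 1 + G 2 h    ≡⟨ cong₂ (λ x y → x + 1 + y) (oneDescentsFrom-length-2 (suc (suc h))) (oneDescentsFrom-length-2 h) ⟩
      3                                ≡⟨ cong (λ x → 2 * x + 1 + 0) (sym (oneDescentsFrom-length-2 (suc h))) ⟩
      2 * G 2 (suc h) + 1 + 0          ∎
    where
    open ≡-Reasoning
    G : ℕ → ℕ → ℕ
    G n h = oneDescentsFrom n h 2
  oneDescentsFrom-2-recurrence (suc n) zero = begin
      G (4 + n) 0
    ≡⟨ oneDescentsFrom-2-step-zero (2 + n) ⟩
      G (3 + n) 1 + 2 * 2 ^ suc n + G (3 + n) 0
    ≡⟨ cong₂ (λ x y → x + 2 * 2 ^ suc n + y) (oneDescentsFrom-2-recurrence n 1) (oneDescentsFrom-2-recurrence n 0) ⟩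
      (2 * G (2 + n) 1 + 2 ^ n + Z n 1) + 2 * 2 ^ suc n + (2 * G (2 + n) 0 + 2 ^ n + Z n 0)
    ≡⟨ shuffle (G (2 + n) 1) (G (2 + n) 0) (2 ^ n) (Z n 1) (Z n 0) ⟩
      2 * (G (2 + n) 1 + 2 * 2 ^ n + G (2 + n) 0) + 2 ^ suc n + (Z n 1 + Z n 0)
    ≡⟨ cong (λ x → 2 * x + 2 ^ suc n + Z (suc n) 0) (sym (oneDescentsFrom-2-step-zero (suc n))) ⟩
      2 * G (3 + n) 0 + 2 ^ suc n + Z (suc n) 0
    ∎
    where
    open ≡-Reasoning
    G Z : ℕ → ℕ → ℕ
    G n h = oneDescentsFrom n h 2
    Z = dispersedToAxis
    shuffle : ∀ x y p z₁ z₀ → (2 * x + p + z₁) + 2 * (2 * p) + (2 * y + p + z₀) ≡ 2 * (x + 2 * p + y) + 2 * p + (z₁ + z₀)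
    shuffle = solve-∀
  oneDescentsFrom-2-recurrence (suc n) (suc h) = begin
      G (4 + n) (suc h)
    ≡⟨ oneDescentsFrom-2-step-suc (2 + n) h ⟩
      G (3 + n) (suc (suc h)) + 2 ^ suc n + G (3 + n) h
    ≡⟨ cong₂ (λ x y → x + 2 ^ suc n + y) (oneDescentsFrom-2-recurrence n (suc (suc h))) (oneDescentsFrom-2-recurrence n h) ⟩
      (2 * G (2 + n) (suc (suc h)) + 2 ^ n + Z n (suc (suc h))) + 2 ^ suc n + (2 * G (2 + n) h + 2 ^ n + Z n h)
    ≡⟨ shuffle (G (2 + n) (suc (suc h))) (G (2 + n) h) (2 ^ n) (Z n (suc (suc h))) (Z n h) ⟩
      2 * (G (2 + n) (suc (suc h)) + 2 ^ n + G (2 + n) h) + 2 ^ suc n + (Z n (suc (suc h)) + Z n h)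
    ≡⟨ cong (λ x → 2 * x + 2 ^ suc n + Z (suc n) (suc h)) (sym (oneDescentsFrom-2-step-suc (suc n) h)) ⟩
      2 * G (3 + n) (suc h) + 2 ^ suc n + Z (suc n) (suc h)
    ∎
    where
    open ≡-Reasoning
    G Z : ℕ → ℕ → ℕ
    G n h = oneDescentsFrom n h 2
    Z = dispersedToAxis
    shuffle : ∀ x y p z₁ z₀ → (2 * x + p + z₁) + 2 * p + (2 * y + p + z₀) ≡ 2 * (x + p + y) + 2 * p + (z₁ + z₀)
    shuffle = solve-∀

  C-recurrence : ∀ n → C (3 + n) ≡ 2 * C (2 + n) + 2 ^ n + dispersedToAxis n 0
  C-recurrence n
    rewrite C≡oneDescentsFrom (3 + n) | C≡oneDescentsFrom (2 + n)
          | oneDescentsFrom-suc-zero-0 (2 + n) | oneDescentsFrom-suc-zero-0 (1 + n) =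
    oneDescentsFrom-2-recurrence n 0

  C-linearRecurrence : ∀ n → 2 * C (4 + n) + 8 * C (2 + n) + 2 * firstPassage (suc n) 1 ≡ 8 * C (3 + n)
  C-linearRecurrence n rewrite C-recurrence (suc n) | C-recurrence n = begin
      2 * (2 * (2 * c + 2 ^ n + Z n 0) + 2 ^ suc n + Z (suc n) 0) + 8 * c + 2 * Q
    ≡⟨ shuffle c (2 ^ n) (Z n 0) (Z (suc n) 0) Q ⟩
      8 * (2 * c + 2 ^ n) + 2 * (2 * Z n 0) + 2 * (Z (suc n) 0 + Q)
    ≡⟨ cong (λ x → 8 * (2 * c + 2 ^ n) + 2 * (2 * Z n 0) + 2 * x) (dispersedToAxis-suc-zero n) ⟩
      8 * (2 * c + 2 ^ n) + 2 * (2 * Z n 0) + 2 * (2 * Z n 0)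
    ≡⟨ collect c (2 ^ n) (Z n 0) ⟩
      8 * (2 * c + 2 ^ n + Z n 0)
    ∎
    where
    open ≡-Reasoning
    Z : ℕ → ℕ → ℕ
    Z = dispersedToAxis
    c Q : ℕ
    c = C (2 + n)
    Q = firstPassage (suc n) 1
    shuffle : ∀ x p z₀ z₁ q → 2 * (2 * (2 * x + p + z₀) + 2 * p + z₁) + 8 * x + 2 * q ≡ 8 * (2 * x + p) + 2 * (2 * z₀) + 2 * (z₁ + q)
    shuffle = solve-∀
    collect : ∀ x p z → 8 * (2 * x + p) + 2 * (2 * z) + 2 * (2 * z) ≡ 8 * (2 * x + p + z)
    collect = solve-∀

module PowerSeries where

  open import Data.Nat as ℕ using (ℕ; zero; suc; _∸_; _≤_; _<_; z≤n; s≤s)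
  import Data.Nat.Properties as ℕ
  open import Data.Nat.Induction using (<-rec)
  open import Data.Integer using (ℤ; +_; -_; _+_; _*_; _-_)
  open import Data.Integer.Properties using (+-0-abelianGroup; pos-+; pos-*; +-identityˡ; +-identityʳ; *-cancelˡ-≡)
  open import Algebra.Properties.AbelianGroup +-0-abelianGroup using (∙-cancelʳ)
  open import Data.Integer.Tactic.RingSolver using (solve-∀)
  import Data.Nat.Tactic.RingSolver as ℕ-Solver
  open Walks using (sumToℕ; sumToℕ-cong; sumToℕ-*; firstPassage; firstPassage-+)
  open OneDescentCounts using (C-linearRecurrence)

  sumTo-cong : ∀ f g n → (∀ i → i ≤ n → f i ≡ g i) → sumTo f n ≡ sumTo g n
  sumTo-cong f g zero f≗g = f≗g 0 z≤n
  sumTo-cong f g (suc n) f≗g = cong₂ _+_ (sumTo-cong f g n (λ i i≤n → f≗g i (ℕ.m≤n⇒m≤1+n i≤n))) (f≗g (suc n) ℕ.≤-refl)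

  sumTo-suc : ∀ f n → sumTo f (suc n) ≡ f 0 + sumTo (λ i → f (suc i)) n
  sumTo-suc f zero = refl
  sumTo-suc f (suc n) rewrite sumTo-suc f n = reassoc (f 0) _ _
    where
    reassoc : ∀ a b c → a + b + c ≡ a + (b + c)
    reassoc = solve-∀

  sumTo-pos : ∀ f n → sumTo (λ i → + f i) n ≡ + sumToℕ f n
  sumTo-pos f zero = refl
  sumTo-pos f (suc n) rewrite sumTo-pos f n = sym (pos-+ (sumToℕ f n) (f (suc n)))

  sumTo-vanishing-tail : ∀ f m k → (∀ i → f (suc m ℕ.+ i) ≡ + 0) → sumTo f (m ℕ.+ k) ≡ sumTo f m
  sumTo-vanishing-tail f m zero _ rewrite ℕ.+-identityʳ m = refl
  sumTo-vanishing-tail f m (suc k) f≡0 rewrite ℕ.+-suc m k | f≡0 k = trans (+-identityʳ _) (sumTo-vanishing-tail f m k f≡0)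

  interior : Series → ℕ → ℤ
  interior S zero = + 0
  interior S (suc m) = sumTo (λ i → S (suc i) * S (suc m ∸ i)) m

  interior-cong : ∀ S R n → (∀ {j} → j ≤ n → S j ≡ R j) → interior S n ≡ interior R n
  interior-cong S R zero _ = refl
  interior-cong S R (suc m) S≗R =
    sumTo-cong _ _ m (λ i i≤m → cong₂ _*_ (S≗R (s≤s i≤m)) (S≗R (ℕ.m∸n≤m (suc m) i)))

  ⊛-square-suc : ∀ S → S 0 ≡ + 1 → ∀ n → (S ⊛ S) (suc n) ≡ + 2 * S (suc n) + interior S n
  ⊛-square-suc S S₀≡1 n = begin
      (S ⊛ S) (suc n)                          ≡⟨ split n ⟩
      S 0 * x + (interior S n + x * S 0)       ≡⟨ cong (λ s → s * x + (interior S n + x * s)) S₀≡1 ⟩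
      + 1 * x + (interior S n + x * + 1)       ≡⟨ collect x (interior S n) ⟩
      + 2 * x + interior S n                   ∎
    where
    open ≡-Reasoning
    x : ℤ
    x = S (suc n)
    split : ∀ n → (S ⊛ S) (suc n) ≡ S 0 * S (suc n) + (interior S n + S (suc n) * S 0)
    split zero = cong (λ m → S 0 * S 1 + m) (sym (+-identityˡ _))
    split (suc m) = trans (sumTo-suc _ (suc m))
      (cong (λ j → S 0 * S (2 ℕ.+ m) + (interior S (suc m) + S (2 ℕ.+ m) * S j)) (ℕ.n∸n≡0 m))
    collect : ∀ x m → + 1 * x + (m + x * + 1) ≡ + 2 * x + m
    collect = solve-∀

  sqrt-unique : ∀ S R → S 0 ≡ + 1 → R 0 ≡ + 1 → (∀ n → (S ⊛ S) n ≡ (R ⊛ R) n) → ∀ n → S n ≡ R n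
  sqrt-unique S R S₀≡1 R₀≡1 S²≗R² = <-rec (λ n → S n ≡ R n) step
    where
    open ≡-Reasoning
    step : ∀ n → (∀ {m} → m < n → S m ≡ R m) → S n ≡ R n
    step zero _ = trans S₀≡1 (sym R₀≡1)
    step (suc n) S≗R = *-cancelˡ-≡ (+ 2) _ _ (∙-cancelʳ (interior S n) _ _ (begin
        + 2 * S (suc n) + interior S n   ≡⟨ sym (⊛-square-suc S S₀≡1 n) ⟩
        (S ⊛ S) (suc n)                  ≡⟨ S²≗R² (suc n) ⟩
        (R ⊛ R) (suc n)                  ≡⟨ ⊛-square-suc R R₀≡1 n ⟩
        + 2 * R (suc n) + interior R n   ≡⟨ cong (λ m → + 2 * R (suc n) + m) (interior-cong R S n (λ j≤n → sym (S≗R (s≤s j≤n)))) ⟩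
        + 2 * R (suc n) + interior S n   ∎))

  -- firstPassage (2m+1) 1 is the m-th Catalan number and firstPassage (2m) 1 = 0,
  -- so this is 1 − 2 Σ Cat m z^(2m+2).
  sqrt1-4z² : Series
  sqrt1-4z² zero = + 1
  sqrt1-4z² (suc n) = - (+ (2 ℕ.* firstPassage n 1))

  interior-sqrt1-4z² : ∀ m → interior sqrt1-4z² (suc m) ≡ + (4 ℕ.* firstPassage m 2)
  interior-sqrt1-4z² m = begin
      sumTo (λ i → sqrt1-4z² (suc i) * sqrt1-4z² (suc m ∸ i)) m
    ≡⟨ sumTo-cong _ _ m (λ i i≤m → trans (cong (λ j → sqrt1-4z² (suc i) * sqrt1-4z² j) (ℕ.+-∸-assoc 1 i≤m))
                                         (neg*neg (2 ℕ.* Q i 1) (2 ℕ.* Q (m ∸ i) 1))) ⟩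
      sumTo (λ i → + (2 ℕ.* Q i 1 ℕ.* (2 ℕ.* Q (m ∸ i) 1))) m
    ≡⟨ sumTo-pos _ m ⟩
      + sumToℕ (λ i → 2 ℕ.* Q i 1 ℕ.* (2 ℕ.* Q (m ∸ i) 1)) m
    ≡⟨ cong +_ (sumToℕ-cong _ _ m (λ i → regroup (Q i 1) (Q (m ∸ i) 1))) ⟩
      + sumToℕ (λ i → 4 ℕ.* (Q i 1 ℕ.* Q (m ∸ i) 1)) m
    ≡⟨ cong +_ (trans (sumToℕ-* 4 _ m) (cong (4 ℕ.*_) (sym (firstPassage-+ m 1 1)))) ⟩
      + (4 ℕ.* Q m 2)
    ∎
    where
    open ≡-Reasoning
    Q : ℕ → ℕ → ℕ
    Q = firstPassage
    neg*neg : ∀ a b → - (+ a) * - (+ b) ≡ + (a ℕ.* b)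
    neg*neg a b rewrite pos-* a b = sign (+ a) (+ b)
      where
      sign : ∀ x y → - x * - y ≡ x * y
      sign = solve-∀
    regroup : ∀ a b → 2 ℕ.* a ℕ.* (2 ℕ.* b) ≡ 4 ℕ.* (a ℕ.* b)
    regroup = ℕ-Solver.solve-∀

  sqrt1-4z²-square : ∀ n → (sqrt1-4z² ⊛ sqrt1-4z²) n ≡ oneMinus4z² n
  sqrt1-4z²-square zero = refl
  sqrt1-4z²-square (suc zero) = refl
  sqrt1-4z²-square (suc (suc m)) = begin
      (sqrt1-4z² ⊛ sqrt1-4z²) (2 ℕ.+ m)
    ≡⟨ ⊛-square-suc sqrt1-4z² refl (suc m) ⟩
      + 2 * - (+ (2 ℕ.* (Q m 2 ℕ.+ Q m 0))) + interior sqrt1-4z² (suc m)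
    ≡⟨ cong (λ x → + 2 * - (+ (2 ℕ.* (Q m 2 ℕ.+ Q m 0))) + x) (interior-sqrt1-4z² m) ⟩
      + 2 * - (+ (2 ℕ.* (Q m 2 ℕ.+ Q m 0))) + + (4 ℕ.* Q m 2)
    ≡⟨ cancel (Q m 2) (Q m 0) ⟩
      - (+ (4 ℕ.* Q m 0))
    ≡⟨ atZero m ⟩
      oneMinus4z² (2 ℕ.+ m)
    ∎
    where
    open ≡-Reasoning
    Q : ℕ → ℕ → ℕ
    Q = firstPassage
    cancel : ∀ a b → + 2 * - (+ (2 ℕ.* (a ℕ.+ b))) + + (4 ℕ.* a) ≡ - (+ (4 ℕ.* b))
    cancel a b rewrite pos-* 2 (a ℕ.+ b) | pos-+ a b | pos-* 4 a | pos-* 4 b = linear (+ a) (+ b)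
      where
      linear : ∀ x y → + 2 * - (+ 2 * (x + y)) + + 4 * x ≡ - (+ 4 * y)
      linear = solve-∀
    atZero : ∀ m → - (+ (4 ℕ.* Q m 0)) ≡ oneMinus4z² (2 ℕ.+ m)
    atZero zero = refl
    atZero (suc m) = refl

  fromℕ-recurrence : ∀ a b c d → 2 ℕ.* a ℕ.+ 8 ℕ.* c ℕ.+ 2 ℕ.* d ≡ 8 ℕ.* b
    → + 2 * + a + - (+ 8) * + b + + 8 * + c ≡ - (+ (2 ℕ.* d))
  fromℕ-recurrence a b c d eq = begin
      + 2 * + a + - (+ 8) * + b + + 8 * + c
    ≡⟨ rearrange (+ a) (+ b) (+ c) (+ d) ⟩
      (+ 2 * + a + + 8 * + c + + 2 * + d) - + 8 * + b - + 2 * + d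
    ≡⟨ cong (λ x → x - + 8 * + b - + 2 * + d) lifted ⟩
      + 8 * + b - + 8 * + b - + 2 * + d
    ≡⟨ cancel (+ b) (+ d) ⟩
      - (+ 2 * + d)
    ≡⟨ cong -_ (sym (pos-* 2 d)) ⟩
      - (+ (2 ℕ.* d))
    ∎
    where
    open ≡-Reasoning
    lifted : + 2 * + a + + 8 * + c + + 2 * + d ≡ + 8 * + b
    lifted = begin
        + 2 * + a + + 8 * + c + + 2 * + d
      ≡⟨ sym (cong₂ _+_ (cong₂ _+_ (pos-* 2 a) (pos-* 8 c)) (pos-* 2 d)) ⟩
        + (2 ℕ.* a) + + (8 ℕ.* c) + + (2 ℕ.* d)
      ≡⟨ sym (trans (pos-+ (2 ℕ.* a ℕ.+ 8 ℕ.* c) (2 ℕ.* d)) (cong (_+ + (2 ℕ.* d)) (pos-+ (2 ℕ.* a) (8 ℕ.* c)))) ⟩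
        + (2 ℕ.* a ℕ.+ 8 ℕ.* c ℕ.+ 2 ℕ.* d)
      ≡⟨ cong +_ eq ⟩
        + (8 ℕ.* b)
      ≡⟨ pos-* 8 b ⟩
        + 8 * + b
      ∎
    rearrange : ∀ x y z w → + 2 * x + - (+ 8) * y + + 8 * z ≡ (+ 2 * x + + 8 * z + + 2 * w) - + 8 * y - + 2 * w
    rearrange = solve-∀
    cancel : ∀ y w → + 8 * y - + 8 * y - + 2 * w ≡ - (+ 2 * w)
    cancel = solve-∀

  z²·-cong : ∀ {S R} → (∀ n → S n ≡ R n) → ∀ n → z²· S n ≡ z²· R n
  z²·-cong S≗R zero = refl
  z²·-cong S≗R (suc zero) = refl
  z²·-cong S≗R (suc (suc n)) = S≗R n

  Cgf-identity : ∀ n → (twoOneMinus2zSq ⊛ Cgf) n ≡ (z²· one ⊕ z²· sqrt1-4z²) n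
  Cgf-identity 0 = refl
  Cgf-identity 1 = refl
  Cgf-identity 2 = refl
  Cgf-identity 3 = refl
  Cgf-identity (suc (suc (suc (suc n)))) = begin
      (twoOneMinus2zSq ⊛ Cgf) (4 ℕ.+ n)
    ≡⟨ sumTo-vanishing-tail _ 2 (2 ℕ.+ n) (λ _ → refl) ⟩
      + 2 * + C (4 ℕ.+ n) + - (+ 8) * + C (3 ℕ.+ n) + + 8 * + C (2 ℕ.+ n)
    ≡⟨ fromℕ-recurrence (C (4 ℕ.+ n)) (C (3 ℕ.+ n)) (C (2 ℕ.+ n)) (firstPassage (suc n) 1) (C-linearRecurrence n) ⟩
      sqrt1-4z² (2 ℕ.+ n)
    ≡⟨ sym (+-identityˡ _) ⟩
      (z²· one ⊕ z²· sqrt1-4z²) (4 ℕ.+ n)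
    ∎
    where open ≡-Reasoning

open PowerSeries using (sqrt1-4z²; sqrt1-4z²-square; sqrt-unique; z²·-cong; Cgf-identity)

mainTheorem5 : Σ Series IsSqrt1-4z²
    × (∀ (S : Series) → IsSqrt1-4z² S →
    ∀ n → (twoOneMinus2zSq ⊛ Cgf) n ≡ (z²· one ⊕ z²· S) n)
mainTheorem5 = (sqrt1-4z² , refl , sqrt1-4z²-square) , anySqrt
  where
  anySqrt : ∀ (S : Series) → IsSqrt1-4z² S → ∀ n → (twoOneMinus2zSq ⊛ Cgf) n ≡ (z²· one ⊕ z²· S) n
  anySqrt S (S₀≡1 , S²≗1-4z²) n = trans (Cgf-identity n) (cong (λ x → z²· one n ℤ.+ x) (z²·-cong sqrt≗S n))
    where
    sqrt≗S : ∀ m → sqrt1-4z² m ≡ S m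
    sqrt≗S = sqrt-unique sqrt1-4z² S refl S₀≡1 (λ k → trans (sqrt1-4z²-square k) (sym (S²≗1-4z² k)))
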